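{- If $\phi$ is a sequentially congruent partition, then its conjugate $\phi^*$ satisfies $m_i(\phi^*)\equiv0\pmod i$ for every $i\ge1$. Conversely, if a partition $\mu$ satisfies $m_i(\mu)\equiv0\pmod i$ for every $i\ge1$, then its conjugate $\mu^*$ is sequentially congruent.
   Context: A partition $\phi=(\phi_1,\dots,\phi_r)$, $\phi_1\ge\dots\ge\phi_r\ge1$, is sequentially congruent if $\phi_i\equiv\phi_{i+1}\pmod i$ for $1\le i\le r-1$ and $\phi_r\equiv0\pmod r$ (the empty partition included). $m_i(\mu)$ denotes the multiplicity of $i$ as a part of $\mu$. The conjugate of a partition is the partition whose Ferrers–Young diagram is the transpose. -}

module Defs where

open import Data.Nat using (ℕ; zero; suc; _≤_; _≥_; _<_; _%_; _≟_; _≤?_)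
open import Data.Nat.Divisibility using (_∣_)
open import Data.List using (List; []; _∷_; length; filter; map; upTo; head)
open import Data.List.Relation.Unary.All using (All)
open import Data.List.Relation.Unary.Linked using (Linked)
open import Data.Unit using (⊤)
open import Data.Product using (_×_)
open import Relation.Binary.PropositionalEquality using (_≡_)

IsPartition : List ℕ → Set
IsPartition φ = Linked _≥_ φ × All (λ x → 1 ≤ x) φ

largest : List ℕ → ℕ
largest [] = 0
largest (x ∷ _) = x

countGE : ℕ → List ℕ → ℕ
countGE k φ = length (filter (k ≤?_) φ)

conjugate : List ℕ → List ℕ
conjugate φ = map (λ k → countGE (suc k) φ) (upTo (largest φ))

mult : ℕ → List ℕ → ℕ
mult i μ = length (filter (i ≟_) μ)

-- seqCongFrom k φ: φ = (φ_k, φ_{k+1}, ..., φ_r) where the first entry has index (suc k)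
-- conditions: φ_i ≡ φ_{i+1} (mod i), φ_r ≡ 0 (mod r)
seqCongFrom : ℕ → List ℕ → Set
seqCongFrom k [] = ⊤
seqCongFrom k (x ∷ []) = suc k ∣ x
seqCongFrom k (x ∷ y ∷ rest) = (x % suc k ≡ y % suc k) × seqCongFrom (suc k) (y ∷ rest)

SeqCongruent : List ℕ → Set
SeqCongruent φ = IsPartition φ × seqCongFrom 0 φ

{-# OPTIONS --safe #-}
module Submission where

-- Reading the conjugate column by column, (μ*)_k = #{j : μ_j ≥ k} = m_k(μ) + (μ*)_{k+1}.  So if
-- k ∣ m_k(μ) for every k, consecutive parts of μ* are congruent modulo their index, and the last
-- part equals m_k(μ).  In the other direction, deleting the first row x of φ turns φ* into the
-- conjugate of the remaining rows with every part raised by one, followed by x − φ₂ parts equal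
-- to 1.  Hence m₁(φ*) = φ₁ − φ₂ and m_{i+1}(φ*) = m_i((φ₂, …)*), and induction on the rows, with
-- the congruence indices shifted by one, gives i ∣ m_i(φ*).

open import Defs
open import Data.Nat using (ℕ; zero; suc; z≤n; s≤s; _+_; _*_; _∸_; _≤_; _≥_; _<_; _%_; _/_; _≟_; _≤?_)
open import Data.Nat.Properties
open import Data.Nat.DivMod using (m≡m%n+[m/n]*n; %-remove-+ˡ)
open import Data.Nat.Divisibility using (_∣_; divides; _∣0)
open import Data.List using (List; []; _∷_; length; filter; map; applyUpTo; replicate; _++_)
open import Data.List.Properties
  using (map-upTo; map-applyUpTo; length-++; length-replicate; filter-++; filter-accept; filter-reject; filter-all; filter-none)
open import Data.List.Relation.Unary.All using (All; []; _∷_)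
import Data.List.Relation.Unary.All as All
import Data.List.Relation.Unary.All.Properties as Allₚ
open import Data.List.Relation.Unary.Linked using (Linked; []; [-]; _∷_)
import Data.List.Relation.Unary.Linked as Linked
import Data.List.Relation.Unary.Linked.Properties as Linkedₚ
open import Data.Unit using (tt)
open import Data.Product using (_×_; _,_; proj₂)
open import Relation.Nullary using (¬_; yes; no)
open import Relation.Binary.PropositionalEquality
open import Relation.Binary.Definitions using (tri<; tri≈; tri>)

%≡%⇒∣∸ : ∀ n {x y} → y ≤ x → x % suc n ≡ y % suc n → suc n ∣ x ∸ y
%≡%⇒∣∸ n {x} {y} y≤x x%≡y% = divides (x / suc n ∸ y / suc n) (begin
    x ∸ y
  ≡⟨ cong₂ _∸_ (m≡m%n+[m/n]*n x (suc n)) (m≡m%n+[m/n]*n y (suc n)) ⟩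
    (x % suc n + x / suc n * suc n) ∸ (y % suc n + y / suc n * suc n)
  ≡⟨ cong (λ r → (x % suc n + x / suc n * suc n) ∸ (r + y / suc n * suc n)) (sym x%≡y%) ⟩
    (x % suc n + x / suc n * suc n) ∸ (x % suc n + y / suc n * suc n)
  ≡⟨ [m+n]∸[m+o]≡n∸o (x % suc n) _ _ ⟩
    x / suc n * suc n ∸ y / suc n * suc n
  ≡⟨ sym (*-distribʳ-∸ (suc n) (x / suc n) (y / suc n)) ⟩
    (x / suc n ∸ y / suc n) * suc n ∎)
  where open ≡-Reasoning

applyUpTo-cong-< : ∀ {A : Set} (f g : ℕ → A) n → (∀ {j} → j < n → f j ≡ g j) → applyUpTo f n ≡ applyUpTo g n
applyUpTo-cong-< f g zero    _   = refl
applyUpTo-cong-< f g (suc n) f≡g =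
  cong₂ _∷_ (f≡g (s≤s z≤n)) (applyUpTo-cong-< (λ j → f (suc j)) (λ j → g (suc j)) n (λ j<n → f≡g (s≤s j<n)))

applyUpTo-+ : ∀ {A : Set} (f : ℕ → A) m n → applyUpTo f (m + n) ≡ applyUpTo f m ++ applyUpTo (λ j → f (m + j)) n
applyUpTo-+ f zero    n = refl
applyUpTo-+ f (suc m) n = cong (f 0 ∷_) (applyUpTo-+ (λ j → f (suc j)) m n)

applyUpTo-const : ∀ {A : Set} (x : A) n → applyUpTo (λ _ → x) n ≡ replicate n x
applyUpTo-const x zero    = refl
applyUpTo-const x (suc n) = cong (x ∷_) (applyUpTo-const x n)

seqCongFrom-applyUpTo : ∀ k (f : ℕ → ℕ) n →
  (∀ j → suc j < n → f j % suc (k + j) ≡ f (suc j) % suc (k + j)) →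
  (∀ m → n ≡ suc m → suc (k + m) ∣ f m) →
  seqCongFrom k (applyUpTo f n)
seqCongFrom-applyUpTo k f zero          _    _    = tt
seqCongFrom-applyUpTo k f (suc zero)    _    last = subst (λ r → suc r ∣ f 0) (+-identityʳ k) (last 0 refl)
seqCongFrom-applyUpTo k f (suc (suc n)) step last =
  subst (λ r → f 0 % suc r ≡ f 1 % suc r) (+-identityʳ k) (step 0 (s≤s (s≤s z≤n))) ,
  seqCongFrom-applyUpTo (suc k) (λ j → f (suc j)) (suc n)
    (λ j j<n → subst (λ r → f (suc j) % suc r ≡ f (suc (suc j)) % suc r) (+-suc k j) (step (suc j) (s≤s j<n)))
    (λ m n≡m → subst (λ r → suc r ∣ f (suc m)) (+-suc k m) (last (suc m) (cong suc n≡m)))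

countGE-∷-accept : ∀ {k x} l → k ≤ x → countGE k (x ∷ l) ≡ suc (countGE k l)
countGE-∷-accept {k} l k≤x = cong length (filter-accept (k ≤?_) k≤x)

countGE-∷-reject : ∀ {k x} l → ¬ k ≤ x → countGE k (x ∷ l) ≡ countGE k l
countGE-∷-reject {k} l k≰x = cong length (filter-reject (k ≤?_) k≰x)

mult-∷-accept : ∀ {i x} l → i ≡ x → mult i (x ∷ l) ≡ suc (mult i l)
mult-∷-accept {i} l i≡x = cong length (filter-accept (i ≟_) i≡x)

mult-∷-reject : ∀ {i x} l → i ≢ x → mult i (x ∷ l) ≡ mult i l
mult-∷-reject {i} l i≢x = cong length (filter-reject (i ≟_) i≢x)

mult-++ : ∀ i xs ys → mult i (xs ++ ys) ≡ mult i xs + mult i ys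
mult-++ i xs ys = trans (cong length (filter-++ (i ≟_) xs ys)) (length-++ (filter (i ≟_) xs))

mult-map-suc : ∀ i xs → mult (suc i) (map suc xs) ≡ mult i xs
mult-map-suc i [] = refl
mult-map-suc i (x ∷ xs) with i ≟ x
... | yes i≡x rewrite mult-∷-accept (map suc xs) (cong suc i≡x) | mult-∷-accept xs i≡x =
  cong suc (mult-map-suc i xs)
... | no i≢x rewrite mult-∷-reject (map suc xs) (λ e → i≢x (suc-injective e)) | mult-∷-reject xs i≢x =
  mult-map-suc i xs

mult-replicate-≡ : ∀ i n → mult i (replicate n i) ≡ n
mult-replicate-≡ i n = trans (cong length (filter-all (i ≟_) (Allₚ.replicate⁺ n refl))) (length-replicate n)

mult-replicate-≢ : ∀ {i x} n → i ≢ x → mult i (replicate n x) ≡ 0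
mult-replicate-≢ {i} n i≢x = cong length (filter-none (i ≟_) (Allₚ.replicate⁺ n i≢x))

mult-zero : ∀ {xs} → All (λ x → 1 ≤ x) xs → mult 0 xs ≡ 0
mult-zero pos = cong length (filter-none (0 ≟_) (All.map (λ 1≤x 0≡x → 1+n≰n (subst (1 ≤_) (sym 0≡x) 1≤x)) pos))

countGE≡mult+countGE-suc : ∀ k l → countGE k l ≡ mult k l + countGE (suc k) l
countGE≡mult+countGE-suc k [] = refl
countGE≡mult+countGE-suc k (x ∷ l) with <-cmp k x
... | tri< k<x k≢x _
  rewrite countGE-∷-accept l (<⇒≤ k<x) | mult-∷-reject l k≢x | countGE-∷-accept l k<x =
  trans (cong suc (countGE≡mult+countGE-suc k l)) (sym (+-suc _ _))
... | tri≈ _ k≡x _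
  rewrite countGE-∷-accept l (≤-reflexive k≡x) | mult-∷-accept l k≡x | countGE-∷-reject l (<-irrefl k≡x) =
  cong suc (countGE≡mult+countGE-suc k l)
... | tri> _ k≢x k>x
  rewrite countGE-∷-reject l (<⇒≱ k>x) | mult-∷-reject l k≢x | countGE-∷-reject l (<⇒≱ (m<n⇒m<1+n k>x)) =
  countGE≡mult+countGE-suc k l

countGE-suc-≤ : ∀ k l → countGE (suc k) l ≤ countGE k l
countGE-suc-≤ k l = subst (countGE (suc k) l ≤_) (sym (countGE≡mult+countGE-suc k l)) (m≤n+m _ _)

largest-tail≤head : ∀ {x l} → Linked _≥_ (x ∷ l) → largest l ≤ x
largest-tail≤head [-]        = z≤n
largest-tail≤head (x≥y ∷ _) = x≥y

largest<⇒countGE≡0 : ∀ {k l} → Linked _≥_ l → largest l < k → countGE k l ≡ 0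
largest<⇒countGE≡0 {l = []}    _  _   = refl
largest<⇒countGE≡0 {l = x ∷ l} lk x<k =
  trans (countGE-∷-reject l (<⇒≱ x<k)) (largest<⇒countGE≡0 (Linked.tail lk) (≤-<-trans (largest-tail≤head lk) x<k))

conjugate≡applyUpTo : ∀ φ → conjugate φ ≡ applyUpTo (λ k → countGE (suc k) φ) (largest φ)
conjugate≡applyUpTo φ = map-upTo (λ k → countGE (suc k) φ) (largest φ)

conjugate-isPartition : ∀ φ → IsPartition (conjugate φ)
conjugate-isPartition []      = [] , []
conjugate-isPartition (x ∷ l) rewrite conjugate≡applyUpTo (x ∷ l) =
  Linkedₚ.applyUpTo⁺₂ column x (λ k → countGE-suc-≤ (suc k) (x ∷ l)) ,
  Allₚ.applyUpTo⁺₁ column x (λ k<x → subst (1 ≤_) (sym (countGE-∷-accept l k<x)) (s≤s z≤n))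
  where
  column : ℕ → ℕ
  column k = countGE (suc k) (x ∷ l)

conjugate-∷ : ∀ {x l} → Linked _≥_ (x ∷ l) → conjugate (x ∷ l) ≡ map suc (conjugate l) ++ replicate (x ∸ largest l) 1
conjugate-∷ {x} {l} lk = begin
    conjugate (x ∷ l)
  ≡⟨ conjugate≡applyUpTo (x ∷ l) ⟩
    applyUpTo column x
  ≡⟨ cong (applyUpTo column) (sym (m+[n∸m]≡n y≤x)) ⟩
    applyUpTo column (y + (x ∸ y))
  ≡⟨ applyUpTo-+ column y (x ∸ y) ⟩
    applyUpTo column y ++ applyUpTo (λ j → column (y + j)) (x ∸ y)
  ≡⟨ cong₂ _++_ lowColumns highColumns ⟩
    map suc (conjugate l) ++ replicate (x ∸ y) 1 ∎
  where
  open ≡-Reasoning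
  y = largest l
  column : ℕ → ℕ
  column k = countGE (suc k) (x ∷ l)
  y≤x : y ≤ x
  y≤x = largest-tail≤head lk
  lowColumns : applyUpTo column y ≡ map suc (conjugate l)
  lowColumns = begin
      applyUpTo column y
    ≡⟨ applyUpTo-cong-< column _ y (λ k<y → countGE-∷-accept l (≤-trans k<y y≤x)) ⟩
      applyUpTo (λ k → suc (countGE (suc k) l)) y
    ≡⟨ sym (map-applyUpTo (λ k → countGE (suc k) l) suc y) ⟩
      map suc (applyUpTo (λ k → countGE (suc k) l) y)
    ≡⟨ cong (map suc) (sym (conjugate≡applyUpTo l)) ⟩
      map suc (conjugate l) ∎
  highColumns : applyUpTo (λ j → column (y + j)) (x ∸ y) ≡ replicate (x ∸ y) 1
  highColumns = trans
    (applyUpTo-cong-< _ _ (x ∸ y) (λ {j} j<x∸y →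
      trans (countGE-∷-accept l (subst (y + j <_) (m+[n∸m]≡n y≤x) (+-monoʳ-< y j<x∸y)))
            (cong suc (largest<⇒countGE≡0 (Linked.tail lk) (s≤s (m≤m+n y j))))))
    (applyUpTo-const 1 (x ∸ y))

mult-one-conjugate-∷ : ∀ {x l} → Linked _≥_ (x ∷ l) → mult 1 (conjugate (x ∷ l)) ≡ x ∸ largest l
mult-one-conjugate-∷ {x} {l} lk = begin
    mult 1 (conjugate (x ∷ l))
  ≡⟨ cong (mult 1) (conjugate-∷ lk) ⟩
    mult 1 (map suc (conjugate l) ++ replicate (x ∸ largest l) 1)
  ≡⟨ mult-++ 1 (map suc (conjugate l)) _ ⟩
    mult 1 (map suc (conjugate l)) + mult 1 (replicate (x ∸ largest l) 1)
  ≡⟨ cong₂ _+_ (trans (mult-map-suc 0 (conjugate l)) (mult-zero (proj₂ (conjugate-isPartition l))))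
               (mult-replicate-≡ 1 (x ∸ largest l)) ⟩
    x ∸ largest l ∎
  where open ≡-Reasoning

mult-suc-conjugate-∷ : ∀ {x l} i → Linked _≥_ (x ∷ l) → mult (2 + i) (conjugate (x ∷ l)) ≡ mult (suc i) (conjugate l)
mult-suc-conjugate-∷ {x} {l} i lk = begin
    mult (2 + i) (conjugate (x ∷ l))
  ≡⟨ cong (mult (2 + i)) (conjugate-∷ lk) ⟩
    mult (2 + i) (map suc (conjugate l) ++ replicate (x ∸ largest l) 1)
  ≡⟨ mult-++ (2 + i) (map suc (conjugate l)) _ ⟩
    mult (2 + i) (map suc (conjugate l)) + mult (2 + i) (replicate (x ∸ largest l) 1)
  ≡⟨ cong₂ _+_ (mult-map-suc (suc i) (conjugate l)) (mult-replicate-≢ (x ∸ largest l) (λ ())) ⟩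
    mult (suc i) (conjugate l) + 0
  ≡⟨ +-identityʳ _ ⟩
    mult (suc i) (conjugate l) ∎
  where open ≡-Reasoning

seqCongFrom-∷⇒∣∸ : ∀ k {x l} → Linked _≥_ (x ∷ l) → seqCongFrom k (x ∷ l) → suc k ∣ x ∸ largest l
seqCongFrom-∷⇒∣∸ k {l = []}    _         k+1∣x       = k+1∣x
seqCongFrom-∷⇒∣∸ k {l = _ ∷ _} (y≤x ∷ _) (x≡y , _) = %≡%⇒∣∸ k y≤x x≡y

seqCongFrom-tail : ∀ k {x l} → seqCongFrom k (x ∷ l) → seqCongFrom (suc k) l
seqCongFrom-tail k {l = []}    _       = tt
seqCongFrom-tail k {l = _ ∷ _} (_ , s) = s

seqCongFrom⇒∣mult-conjugate : ∀ k {φ} → Linked _≥_ φ → seqCongFrom k φ → ∀ i → k + suc i ∣ mult (suc i) (conjugate φ)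
seqCongFrom⇒∣mult-conjugate k {[]}    _  _  i       = _ ∣0
seqCongFrom⇒∣mult-conjugate k {x ∷ l} lk sc zero    =
  subst₂ _∣_ (+-comm 1 k) (sym (mult-one-conjugate-∷ lk)) (seqCongFrom-∷⇒∣∸ k lk sc)
seqCongFrom⇒∣mult-conjugate k {x ∷ l} lk sc (suc i) =
  subst₂ _∣_ (sym (+-suc k (suc i))) (sym (mult-suc-conjugate-∷ i lk))
    (seqCongFrom⇒∣mult-conjugate (suc k) (Linked.tail lk) (seqCongFrom-tail k sc) i)

∣mult⇒seqCongruent-conjugate : ∀ μ → Linked _≥_ μ → (∀ i → suc i ∣ mult (suc i) μ) → SeqCongruent (conjugate μ)
∣mult⇒seqCongruent-conjugate μ lk i∣mult =
  conjugate-isPartition μ ,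
  subst (seqCongFrom 0) (sym (conjugate≡applyUpTo μ))
    (seqCongFrom-applyUpTo 0 (λ k → countGE (suc k) μ) (largest μ) step lastColumn)
  where
  step : ∀ j → suc j < largest μ → countGE (suc j) μ % suc j ≡ countGE (2 + j) μ % suc j
  step j _ = trans (cong (_% suc j) (countGE≡mult+countGE-suc (suc j) μ)) (%-remove-+ˡ _ (i∣mult j))
  lastColumn : ∀ m → largest μ ≡ suc m → suc m ∣ countGE (suc m) μ
  lastColumn m μ₁≡m+1 = subst (suc m ∣_) (sym (begin
      countGE (suc m) μ
    ≡⟨ countGE≡mult+countGE-suc (suc m) μ ⟩
      mult (suc m) μ + countGE (2 + m) μ
    ≡⟨ cong (mult (suc m) μ +_) (largest<⇒countGE≡0 lk (≤-reflexive (cong suc μ₁≡m+1))) ⟩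
      mult (suc m) μ + 0
    ≡⟨ +-identityʳ _ ⟩
      mult (suc m) μ ∎)) (i∣mult m)
    where open ≡-Reasoning

theorem4p1 : ((φ : List ℕ) → SeqCongruent φ → (i : ℕ) → suc i ∣ mult (suc i) (conjugate φ))
    × ((μ : List ℕ) → IsPartition μ → ((i : ℕ) → suc i ∣ mult (suc i) μ) → SeqCongruent (conjugate μ))
theorem4p1 =
  (λ φ ((lk , _) , sc) → seqCongFrom⇒∣mult-conjugate 0 lk sc) ,
  (λ μ (lk , _) → ∣mult⇒seqCongruent-conjugate μ lk)
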